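{- Let $(G,\sigma)$ be a properly 2-colored digraph satisfying (N1), (N2) and (N3). Then $\mathcal{R}'=\{R'(x)\mid x\in V(G)\}\setminus\{\emptyset\}$ is hierarchy-like, i.e., $A\cap B\in\{\emptyset,A,B\}$ for all $A,B\in\mathcal{R}'$.
   Context: $G$ is a finite simple digraph with a proper coloring $\sigma\colon V(G)\to\{r,s\}$ (adjacent vertices have distinct colors). $N(x)$ and $N^-(x)$ are the out- and in-neighbourhoods of $x$, and $N(A)=\bigcup_{x\in A}N(x)$. (N1): for all $x,y$, if $x\notin N(y)$ and $y\notin N(x)$ then $N(x)\cap N(N(y))=N(y)\cap N(N(x))=\emptyset$; (N2): $N(N(N(x)))\subseteq N(x)$; (N3): $N(x)\cap N(y)\ne\emptyset$ implies $N(x)\subseteq N(y)$ or $N(y)\subseteq N(x)$. $R(x)=N(x)\cup N(N(x))\cup N(N(N(x)))\cup\cdots$; $Q(x)=\{y\in V(G) : N^-(y)=N^-(x)\text{ and }\emptyset\ne N(y)\subseteq N(x)\}$; $R'(x)=R(x)\cup Q(x)$. -}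

module Defs where

open import Level using (0ℓ)
open import Data.Nat using (ℕ)
open import Data.Fin using (Fin)
open import Data.Product using (Σ; ∃; _×_; _,_)
open import Data.Sum using (_⊎_)
open import Data.Empty using (⊥)
open import Relation.Nullary using (¬_)
open import Relation.Binary.Core using (Rel)
open import Relation.Binary.Definitions using (Decidable)
open import Relation.Binary.PropositionalEquality using (_≡_; _≢_)

data Colour : Set where
  r s : Colour

-- A finite simple digraph on vertex set Fin n: an arc relation (x ⇒ y means
-- there is an arc x → y, i.e. y ∈ N(x)), decidable (finite data), loopless.
-- Parallel arcs cannot occur since arcs form a relation.
record Digraph : Set₁ where
  field
    n     : ℕ
    _⇒_   : Rel (Fin n) 0ℓ
    dec   : Decidable _⇒_
    loopless : ∀ x → ¬ (x ⇒ x)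

module _ (G : Digraph) where
  open Digraph G

  V : Set
  V = Fin n

  VSet : Set₁
  VSet = V → Set

  _⊆_ : VSet → VSet → Set
  A ⊆ B = ∀ z → A z → B z

  N : V → VSet
  N x y = x ⇒ y

  N⁻ : V → VSet
  N⁻ x y = y ⇒ x

  NS : VSet → VSet
  NS A y = Σ V λ x → A x × (x ⇒ y)

  ProperColouring : (V → Colour) → Set
  ProperColouring σ = ∀ x y → x ⇒ y → σ x ≢ σ y

  N1 : Set
  N1 = ∀ x y → ¬ N y x → ¬ N x y →
         (∀ z → ¬ (N x z × NS (N y) z)) × (∀ z → ¬ (N y z × NS (N x) z))

  N2 : Set
  N2 = ∀ x → NS (NS (N x)) ⊆ N x

  N3 : Set
  N3 = ∀ x y → (Σ V λ z → N x z × N y z) → (N x ⊆ N y) ⊎ (N y ⊆ N x)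

  -- R(x) = N(x) ∪ N(N(x)) ∪ ... : vertices reachable from x by a walk of length ≥ 1
  data R (x : V) : VSet where
    here  : ∀ {y} → x ⇒ y → R x y
    there : ∀ {y z} → R x y → y ⇒ z → R x z

  Q : V → VSet
  Q x y = (N⁻ y ⊆ N⁻ x) × (N⁻ x ⊆ N⁻ y) × (Σ V λ z → N y z) × (N y ⊆ N x)

  R' : V → VSet
  R' x y = R x y ⊎ Q x y

  NonEmpty : VSet → Set
  NonEmpty A = Σ V A

  HierarchyPair : VSet → VSet → Set
  HierarchyPair A B = (∀ z → ¬ (A z × B z)) ⊎ (A ⊆ B) ⊎ (B ⊆ A)

  R'HierarchyLike : Set
  R'HierarchyLike = ∀ x y → NonEmpty (R' x) → NonEmpty (R' y) → HierarchyPair (R' x) (R' y)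

-- R' is closed under taking R' of its members, for every digraph.  Under (N2)
-- every vertex of R(x) lies in N(x) ∪ N(N(x)).  Hence for two vertices x, y
-- either one is within distance 2 of the other, so that R'(y) ⊆ R'(x) or
-- R'(x) ⊆ R'(y); or they share an out-neighbour, and then (N1) forces equal
-- in-neighbourhoods and (N3) nested out-neighbourhoods, so one lies in Q of the
-- other; or else (N1) makes R'(x) and R'(y) disjoint.
module Submission where

open import Defs
open import Data.Fin.Properties using (any?)
open import Data.Product using (Σ; _×_; _,_; proj₁; proj₂)
open import Data.Sum using (_⊎_; inj₁; inj₂)
open import Data.Empty using (⊥; ⊥-elim)
open import Relation.Nullary using (¬_; Dec; yes; no)
open import Relation.Nullary.Decidable using (_×-dec_; _⊎-dec_)

module _ (G : Digraph) where
  open Digraph G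

  N∪N² : V G → VSet G
  N∪N² x y = x ⇒ y ⊎ NS G (N G x) y

  CommonOutNeighbour : V G → V G → Set
  CommonOutNeighbour x y = Σ (V G) λ u → x ⇒ u × y ⇒ u

  Disjoint : VSet G → VSet G → Set
  Disjoint A B = ∀ z → ¬ (A z × B z)

  N∪N²? : ∀ x y → Dec (N∪N² x y)
  N∪N²? x y = dec x y ⊎-dec any? (λ w → dec x w ×-dec dec w y)

  commonOutNeighbour? : ∀ x y → Dec (CommonOutNeighbour x y)
  commonOutNeighbour? x y = any? (λ u → dec x u ×-dec dec y u)

  N∪N²⊆R : ∀ x → _⊆_ G (N∪N² x) (R G x)
  N∪N²⊆R x y (inj₁ xy)           = here xy
  N∪N²⊆R x y (inj₂ (w , xw , wy)) = there (here xw) wy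

  R-trans : ∀ {x v u} → R G x v → R G v u → R G x u
  R-trans rxv (here vu)     = there rxv vu
  R-trans rxv (there rvw wu) = there (R-trans rxv rvw) wu

  R-mono : ∀ {x v} → _⊆_ G (N G v) (N G x) → _⊆_ G (R G v) (R G x)
  R-mono Nv⊆Nx u (here vu)      = here (Nv⊆Nx u vu)
  R-mono Nv⊆Nx u (there rvw wu) = there (R-mono Nv⊆Nx _ rvw) wu

  R-transport-N⁻ : ∀ {x v u} → _⊆_ G (N⁻ G v) (N⁻ G u) → R G x v → R G x u
  R-transport-N⁻ N⁻v⊆N⁻u (here xv)      = here (N⁻v⊆N⁻u _ xv)
  R-transport-N⁻ N⁻v⊆N⁻u (there rxw wv) = there rxw (N⁻v⊆N⁻u _ wv)

  Q-trans : ∀ {x v u} → Q G x v → Q G v u → Q G x u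
  Q-trans (N⁻v⊆N⁻x , N⁻x⊆N⁻v , _ , Nv⊆Nx) (N⁻u⊆N⁻v , N⁻v⊆N⁻u , outU , Nu⊆Nv) =
    (λ w p → N⁻v⊆N⁻x w (N⁻u⊆N⁻v w p)) , (λ w p → N⁻v⊆N⁻u w (N⁻x⊆N⁻v w p)) ,
    outU , (λ w p → Nv⊆Nx w (Nu⊆Nv w p))

  R'-trans : ∀ {x v u} → R' G x v → R' G v u → R' G x u
  R'-trans (inj₁ rxv)                (inj₁ rvu)             = inj₁ (R-trans rxv rvu)
  R'-trans (inj₂ (_ , _ , _ , Nv⊆Nx)) (inj₁ rvu)             = inj₁ (R-mono Nv⊆Nx _ rvu)
  R'-trans (inj₁ rxv)                (inj₂ (_ , N⁻v⊆N⁻u , _)) = inj₁ (R-transport-N⁻ N⁻v⊆N⁻u rxv)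
  R'-trans (inj₂ qxv)                (inj₂ qvu)             = inj₂ (Q-trans qxv qvu)

  R'-⊆ : ∀ {x v} → R' G x v → _⊆_ G (R' G v) (R' G x)
  R'-⊆ x∈R'v _ = R'-trans x∈R'v

  Q-disjoint : ∀ {x y} → ¬ CommonOutNeighbour x y → Disjoint (Q G x) (Q G y)
  Q-disjoint noCommon z ((_ , _ , (v , zv) , Nz⊆Nx) , (_ , _ , _ , Nz⊆Ny)) =
    noCommon (v , Nz⊆Nx v zv , Nz⊆Ny v zv)

  module _ (n2 : N2 G) where

    R⊆N∪N² : ∀ x → _⊆_ G (R G x) (N∪N² x)
    R⊆N∪N² x y (here xy) = inj₁ xy
    R⊆N∪N² x z (there {y} rxy yz) with R⊆N∪N² x y rxy
    ... | inj₁ xy    = inj₂ (y , xy , yz)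
    ... | inj₂ x²y   = inj₁ (n2 x z (y , x²y , yz))

  module _ (n1 : N1 G) where

    far-N⁻-⊆ : ∀ {x y} → ¬ N∪N² y x → CommonOutNeighbour x y → _⊆_ G (N⁻ G x) (N⁻ G y)
    far-N⁻-⊆ {x} {y} ¬y²x (u , xu , yu) w wx with dec w y | dec y w
    ... | yes wy | _      = wy
    ... | no _   | yes yw = ⊥-elim (¬y²x (inj₂ (w , yw , wx)))
    ... | no ¬wy | no ¬yw = ⊥-elim (proj₂ (n1 w y ¬yw ¬wy) u (yu , (x , wx , xu)))

    far-N∪N²-disjoint : ∀ {x y} → ¬ N∪N² x y → ¬ N∪N² y x → ¬ CommonOutNeighbour x y →
                        Disjoint (N∪N² x) (N∪N² y)
    far-N∪N²-disjoint {x} {y} ¬x²y ¬y²x noCommon z = λ where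
        (inj₁ xz , inj₁ yz) → noCommon (z , xz , yz)
        (inj₁ xz , inj₂ y²z) → proj₁ nonadjacent z (xz , y²z)
        (inj₂ x²z , inj₁ yz) → proj₂ nonadjacent z (yz , x²z)
        (inj₂ x²z , inj₂ (w , yw , wz)) → via w yw wz x²z
      where
        nonadjacent : (∀ z → ¬ (x ⇒ z × NS G (N G y) z)) × (∀ z → ¬ (y ⇒ z × NS G (N G x) z))
        nonadjacent = n1 x y (λ yx → ¬y²x (inj₁ yx)) (λ xy → ¬x²y (inj₁ xy))
        via : ∀ w → y ⇒ w → w ⇒ z → NS G (N G x) z → ⊥
        via w yw wz x²z with dec x w | dec w x
        ... | yes xw | _      = noCommon (w , xw , yw)
        ... | no _   | yes wx = ¬y²x (inj₂ (w , yw , wx))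
        ... | no ¬xw | no ¬wx = proj₂ (n1 x w ¬wx ¬xw) z (wz , x²z)

    far-Q : N3 G → ∀ {x y} → ¬ N∪N² x y → ¬ N∪N² y x → CommonOutNeighbour x y → Q G x y ⊎ Q G y x
    far-Q n3 {x} {y} ¬x²y ¬y²x common@(u , xu , yu) = nested (n3 x y common)
      where
        N⁻x⊆N⁻y : _⊆_ G (N⁻ G x) (N⁻ G y)
        N⁻x⊆N⁻y = far-N⁻-⊆ ¬y²x common
        N⁻y⊆N⁻x : _⊆_ G (N⁻ G y) (N⁻ G x)
        N⁻y⊆N⁻x = far-N⁻-⊆ ¬x²y (u , yu , xu)
        nested : _⊆_ G (N G x) (N G y) ⊎ _⊆_ G (N G y) (N G x) → Q G x y ⊎ Q G y x
        nested (inj₁ Nx⊆Ny) = inj₂ (N⁻x⊆N⁻y , N⁻y⊆N⁻x , (u , xu) , Nx⊆Ny)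
        nested (inj₂ Ny⊆Nx) = inj₁ (N⁻y⊆N⁻x , N⁻x⊆N⁻y , (u , yu) , Ny⊆Nx)

  module _ (n1 : N1 G) (n2 : N2 G) (n3 : N3 G) where

    far-R'-disjoint : ∀ {x y} → ¬ N∪N² x y → ¬ N∪N² y x → ¬ CommonOutNeighbour x y →
                      Disjoint (R' G x) (R' G y)
    far-R'-disjoint {x} {y} ¬x²y ¬y²x noCommon z = λ where
        (inj₁ rxz , inj₁ ryz) →
          far-N∪N²-disjoint n1 ¬x²y ¬y²x noCommon z (R⊆N∪N² n2 x z rxz , R⊆N∪N² n2 y z ryz)
        (inj₁ rxz , inj₂ (N⁻z⊆N⁻y , _)) → ¬x²y (R⊆N∪N² n2 x y (R-transport-N⁻ N⁻z⊆N⁻y rxz))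
        (inj₂ (N⁻z⊆N⁻x , _) , inj₁ ryz) → ¬y²x (R⊆N∪N² n2 y x (R-transport-N⁻ N⁻z⊆N⁻x ryz))
        (inj₂ qxz , inj₂ qyz) → Q-disjoint noCommon z (qxz , qyz)

    R'-trichotomy : ∀ x y → Disjoint (R' G x) (R' G y) ⊎ R' G x y ⊎ R' G y x
    R'-trichotomy x y with N∪N²? x y | N∪N²? y x
    ... | yes x²y | _       = inj₂ (inj₁ (inj₁ (N∪N²⊆R x y x²y)))
    ... | no _    | yes y²x = inj₂ (inj₂ (inj₁ (N∪N²⊆R y x y²x)))
    ... | no ¬x²y | no ¬y²x with commonOutNeighbour? x y
    ... | no noCommon = inj₁ (far-R'-disjoint ¬x²y ¬y²x noCommon)
    ... | yes common with far-Q n1 n3 ¬x²y ¬y²x common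
    ...   | inj₁ y∈Qx = inj₂ (inj₁ (inj₂ y∈Qx))
    ...   | inj₂ x∈Qy = inj₂ (inj₂ (inj₂ x∈Qy))

lemma15 : (G : Digraph) (σ : V G → Colour) → ProperColouring G σ →
            N1 G → N2 G → N3 G → R'HierarchyLike G
lemma15 G _ _ n1 n2 n3 x y _ _ with R'-trichotomy G n1 n2 n3 x y
... | inj₁ disjoint     = inj₁ disjoint
... | inj₂ (inj₁ y∈R'x) = inj₂ (inj₂ (R'-⊆ G y∈R'x))
... | inj₂ (inj₂ x∈R'y) = inj₂ (inj₁ (R'-⊆ G x∈R'y))
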